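{- Let $p,q$ be distinct primes and write $\Phi_{pq}(z)=\sum_{k=0}^{\varphi(pq)}a_{pq}(k)z^{\varphi(pq)-k}$. Then for every $k\in\{0,1,\ldots,\varphi(pq)\}$, $$a_{pq}(k)=\mathcal H_k(1,\zeta_p,\ldots,\zeta_p^{p-1},\zeta_q,\ldots,\zeta_q^{q-1})\in\{ -1,0,1\}.$$
   Context: $\zeta_n=e^{2\pi i/n}$; $\Phi_n(z)=\prod_{1\le j\le n,\ (j,n)=1}(z-\zeta_n^j)$ is the $n$th cyclotomic polynomial and $\varphi$ is Euler's totient function. For $r\in\mathbb N_0$, $\mathcal H_r(z_1,\ldots,z_n)=\sum_{r_1+\cdots+r_n=r,\ r_i\in\mathbb N_0}z_1^{r_1}\cdots z_n^{r_n}$ is the complete homogeneous symmetric polynomial of degree $r$ (with $\mathcal H_0=1$); here it is evaluated at the $p+q-1$ arguments $1,\zeta_p,\ldots,\zeta_p^{p-1},\zeta_q,\ldots,\zeta_q^{q-1}$. -}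

module Defs where

open import Level using (Level)
open import Algebra.Bundles using (CommutativeRing)
open import Data.Nat as ℕ using (ℕ; zero; suc; _∸_)
open import Data.Nat.GCD using (gcd)
open import Data.List using (List; []; _∷_; length; filter; applyUpTo; upTo; map; foldr; _++_)

coprimesUpTo : ℕ → List ℕ
coprimesUpTo n = filter (λ j → gcd j n ℕ.≟ 1) (applyUpTo suc n)

totient : ℕ → ℕ
totient n = length (coprimesUpTo n)

module Poly {c ℓ : Level} (R : CommutativeRing c ℓ) where
  open CommutativeRing R

  pow : Carrier → ℕ → Carrier
  pow x zero = 1#
  pow x (suc n) = x * pow x n

  -- polynomials as coefficient lists, the i-th entry being the coefficient of z^i
  Pol : Set c
  Pol = List Carrier

  _+ₚ_ : Pol → Pol → Pol
  [] +ₚ g = g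
  (a ∷ f) +ₚ [] = a ∷ f
  (a ∷ f) +ₚ (b ∷ g) = (a + b) ∷ (f +ₚ g)

  _*ₚ_ : Pol → Pol → Pol
  [] *ₚ g = []
  (a ∷ f) *ₚ g = map (a *_) g +ₚ (0# ∷ (f *ₚ g))

  coeff : Pol → ℕ → Carrier
  coeff [] i = 0#
  coeff (a ∷ f) zero = a
  coeff (a ∷ f) (suc i) = coeff f i

  cyclotomic : Carrier → ℕ → Pol
  cyclotomic ω n = foldr (λ j acc → ((- pow ω j) ∷ 1# ∷ []) *ₚ acc) (1# ∷ []) (coprimesUpTo n)

  -- complete homogeneous symmetric polynomial H_k(x_1,…,x_m):
  -- H_k() = [k = 0],  H_k(x, xs) = Σ_{i=0}^{k} x^i H_{k-i}(xs)
  -- (the sum over (r_1,…,r_m) with r_1+…+r_m = k, split on r_1 = i)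
  H : ℕ → List Carrier → Carrier
  H zero [] = 1#
  H (suc k) [] = 0#
  H k (x ∷ xs) = foldr _+_ 0# (map (λ i → pow x i * H (k ∸ i) xs) (upTo (suc k)))

  HArgs : Carrier → Carrier → ℕ → ℕ → List Carrier
  HArgs ζp ζq p q = 1# ∷ (map (pow ζp) (applyUpTo suc (p ∸ 1)) ++ map (pow ζq) (applyUpTo suc (q ∸ 1)))

  ofℕ : ℕ → Carrier
  ofℕ zero = 0#
  ofℕ (suc n) = 1# + ofℕ n

-- Reading polynomials backwards, the coefficient of z^(φ(pq) − k) in Φ_pq is the coefficient
-- of zᵏ in C(z) = ∏_{(j,pq)=1} (1 − ωʲ z), and H_k(1, ζ_p, …, ζ_q^(q−1)) is the coefficient of zᵏ
-- in h(z) = 1 / ((1 − z) A(z) B(z)), where A = ∏_{0<i<p} (1 − ζ_pⁱ z) and B = ∏_{0<i<q} (1 − ζ_qⁱ z).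
-- For a primitive n-th root of unity ζ, ∏_{j=1}^{n} (1 − ζʲ z) = 1 − zⁿ. Sorting the pq-th roots
-- of unity by divisibility of the exponent by p and by q therefore gives 1 − z^(pq) = (1 − z^q) A C,
-- while (1 − z) A = 1 − zᵖ and (1 − z) B = 1 − z^q; hence C = (1 − z^(pq)) h, which agrees with h
-- in degrees below pq > φ(pq). Finally h = (1 − z) N with N = 1 / ((1 − zᵖ)(1 − z^q)), whose
-- coefficient of zᵏ counts the pairs (a, b) with a p + b q = k. For k < pq there is at most one
-- such pair, so the coefficients of N below pq are 0 or 1 and those of h lie in {−1, 0, 1}.
module Submission where

open import Algebra.Bundles using (CommutativeRing)
open import Algebra.Definitions using (Congruent₁)
open import Algebra.Solver.Ring.AlmostCommutativeRing using (_-Raw-AlmostCommutative⟶_; fromCommutativeRing)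
open import Data.Integer.Base as ℤ using (ℤ; +_; -[1+_]; _⊖_)
import Data.Integer.Properties as ℤ
open import Data.List.Base using (List; []; _∷_; _++_; map; foldr; length; upTo; applyUpTo)
import Data.List.Properties as List
open import Data.List.Relation.Binary.Permutation.Propositional as ↭ using (_↭_; prep; swap)
import Data.List.Relation.Binary.Permutation.Propositional.Properties as ↭
open import Data.Maybe.Base using (Maybe; just; nothing)
open import Data.Nat.Base as ℕ using (ℕ; zero; suc; _∸_; _≤_; _<_)
import Data.Nat.Properties as ℕ
open import Data.Nat.Primality using (Prime; prime⇒irreducible; prime⇒nonZero; prime⇒nonTrivial; euclidsLemma; ¬prime[1])
open import Data.Product.Base using (_×_; _,_; proj₁; proj₂)
import Data.Product.Base as ×
open import Data.Sum.Base as Sum using (_⊎_; inj₁; inj₂)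
open import Function.Base using (_∘_)
open import Level using (Level; _⊔_)
open import Relation.Binary.Bundles using (Setoid)
open import Relation.Binary.Core using (Rel)
open import Relation.Binary.Definitions using (tri<; tri≈; tri>)
open import Relation.Binary.PropositionalEquality.Core as ≡ using (_≡_; _≢_; cong; cong₂) renaming (refl to ≡-refl)
open import Relation.Nullary.Decidable.Core using (Dec; yes; no)
open import Relation.Nullary.Negation.Core using (¬_; contradiction)

open import Defs

-- Algebra.Solver.Ring normalises over a coefficient ring with decidable equality;
-- ℤ serves, through its canonical map into R.
module IntegerCoefficients {c ℓ} (R : CommutativeRing c ℓ) where
  open CommutativeRing R hiding (zero)
  open import Algebra.Properties.Ring ring
    using (-0#≈0#; -‿involutive; -‿+-comm; -‿distribˡ-*; -‿distribʳ-*)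
  open import Algebra.Properties.Semiring.Mult.TCOptimised semiring
    using (1+×; ×-homo-+; ×1-homo-*) renaming (_×_ to _·_)
  open import Relation.Binary.Reasoning.Setoid setoid

  private
    fromℤ : ℤ → Carrier
    fromℤ (+ n)     = n · 1#
    fromℤ -[1+ n ]  = - (suc n · 1#)

    [1+a]-[1+b]≈a-b : ∀ a b → (1# + a) - (1# + b) ≈ a - b
    [1+a]-[1+b]≈a-b a b = begin
      (1# + a) + - (1# + b)    ≈⟨ +-congˡ (-‿+-comm 1# b) ⟨
      (1# + a) + (- 1# + - b)  ≈⟨ +-congʳ (+-comm 1# a) ⟩
      (a + 1#) + (- 1# + - b)  ≈⟨ +-assoc a 1# _ ⟩
      a + (1# + (- 1# + - b))  ≈⟨ +-congˡ (+-assoc 1# (- 1#) (- b)) ⟨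
      a + ((1# - 1#) + - b)    ≈⟨ +-congˡ (+-congʳ (-‿inverseʳ 1#)) ⟩
      a + (0# + - b)           ≈⟨ +-congˡ (+-identityˡ (- b)) ⟩
      a - b                    ∎

    ⊖-homo : ∀ m n → fromℤ (m ⊖ n) ≈ m · 1# - n · 1#
    ⊖-homo zero    zero    = sym (-‿inverseʳ 0#)
    ⊖-homo zero    (suc n) = sym (+-identityˡ _)
    ⊖-homo (suc m) zero    = sym (trans (+-congˡ -0#≈0#) (+-identityʳ _))
    ⊖-homo (suc m) (suc n) = begin
      fromℤ (suc m ⊖ suc n)          ≡⟨ cong fromℤ (ℤ.[1+m]⊖[1+n]≡m⊖n m n) ⟩
      fromℤ (m ⊖ n)                  ≈⟨ ⊖-homo m n ⟩
      m · 1# - n · 1#                ≈⟨ [1+a]-[1+b]≈a-b _ _ ⟨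
      (1# + m · 1#) - (1# + n · 1#)  ≈⟨ +-cong (1+× m 1#) (-‿cong (1+× n 1#)) ⟨
      suc m · 1# - suc n · 1#        ∎

    +-homo : ∀ i j → fromℤ (i ℤ.+ j) ≈ fromℤ i + fromℤ j
    +-homo (+ m)     (+ n)     = ×-homo-+ 1# m n
    +-homo (+ m)     -[1+ n ]  = ⊖-homo m (suc n)
    +-homo -[1+ m ]  (+ n)     = trans (⊖-homo n (suc m)) (+-comm _ _)
    +-homo -[1+ m ]  -[1+ n ]  = begin
      - (suc (suc (m ℕ.+ n)) · 1#)     ≡⟨ cong (λ k → - (suc k · 1#)) (ℕ.+-suc m n) ⟨
      - ((suc m ℕ.+ suc n) · 1#)       ≈⟨ -‿cong (×-homo-+ 1# (suc m) (suc n)) ⟩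
      - (suc m · 1# + suc n · 1#)      ≈⟨ -‿+-comm _ _ ⟨
      - (suc m · 1#) + - (suc n · 1#)  ∎

    -‿homo : ∀ i → fromℤ (ℤ.- i) ≈ - fromℤ i
    -‿homo (+ zero)   = sym -0#≈0#
    -‿homo (+ suc n)  = refl
    -‿homo -[1+ n ]   = sym (-‿involutive _)

    +*-homo : ∀ m j → fromℤ (+ m ℤ.* j) ≈ fromℤ (+ m) * fromℤ j
    +*-homo m (+ n) = begin
      fromℤ (+ m ℤ.* + n)  ≡⟨ cong fromℤ (ℤ.pos-* m n) ⟨
      (m ℕ.* n) · 1#       ≈⟨ ×1-homo-* m n ⟩
      m · 1# * n · 1#      ∎
    +*-homo m -[1+ n ] = begin
      fromℤ (+ m ℤ.* -[1+ n ])       ≡⟨ cong fromℤ (ℤ.neg-distribʳ-* (+ m) (+ suc n)) ⟨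
      fromℤ (ℤ.- (+ m ℤ.* + suc n))  ≈⟨ -‿homo (+ m ℤ.* + suc n) ⟩
      - fromℤ (+ m ℤ.* + suc n)      ≈⟨ -‿cong (+*-homo m (+ suc n)) ⟩
      - (m · 1# * suc n · 1#)        ≈⟨ -‿distribʳ-* _ _ ⟩
      m · 1# * - (suc n · 1#)        ∎

    *-homo : ∀ i j → fromℤ (i ℤ.* j) ≈ fromℤ i * fromℤ j
    *-homo (+ m)     j         = +*-homo m j
    *-homo -[1+ m ]  (+ n)     = begin
      fromℤ (-[1+ m ] ℤ.* + n)  ≡⟨ cong fromℤ (ℤ.*-comm -[1+ m ] (+ n)) ⟩
      fromℤ (+ n ℤ.* -[1+ m ])  ≈⟨ +*-homo n -[1+ m ] ⟩
      n · 1# * fromℤ -[1+ m ]   ≈⟨ *-comm _ _ ⟩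
      fromℤ -[1+ m ] * n · 1#   ∎
    *-homo -[1+ m ]  -[1+ n ]  = begin
      (suc m ℕ.* suc n) · 1#  ≈⟨ ×1-homo-* (suc m) (suc n) ⟩
      a * b                   ≈⟨ -‿involutive (a * b) ⟨
      - - (a * b)             ≈⟨ -‿cong (-‿distribʳ-* a b) ⟩
      - (a * - b)             ≈⟨ -‿distribˡ-* a (- b) ⟩
      - a * - b               ∎
      where
      a = suc m · 1#
      b = suc n · 1#

    homomorphism : ℤ.+-*-rawRing -Raw-AlmostCommutative⟶ fromCommutativeRing R
    homomorphism = record
      { ⟦_⟧ = fromℤ ; +-homo = +-homo ; *-homo = *-homo ; -‿homo = -‿homo
      ; 0-homo = refl ; 1-homo = refl
      }

    fromℤ-≟ : ∀ i j → Maybe (fromℤ i ≈ fromℤ j)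
    fromℤ-≟ i j with i ℤ.≟ j
    ... | yes ≡-refl = just refl
    ... | no _       = nothing

  open import Algebra.Solver.Ring ℤ.+-*-rawRing (fromCommutativeRing R) homomorphism fromℤ-≟ public

module PowerSeries {c ℓ} (R : CommutativeRing c ℓ) where
  open CommutativeRing R hiding (zero)
  open Poly R using (pow; H)
  open IntegerCoefficients R
  open import Relation.Binary.Reasoning.Setoid setoid

  Series : Set c
  Series = ℕ → Carrier

  infix 4 _≋_
  _≋_ : Rel Series ℓ
  s ≋ t = ∀ k → s k ≈ t k

  ≋-setoid : Setoid c ℓ
  ≋-setoid = record
    { Carrier       = Series
    ; _≈_           = _≋_
    ; isEquivalence = record
      { refl  = λ _ → refl
      ; sym   = λ e k → sym (e k)
      ; trans = λ e f k → trans (e k) (f k)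
      }
    }

  open Setoid ≋-setoid public
    using () renaming (refl to ≋-refl; sym to ≋-sym; trans to ≋-trans; reflexive to ≋-reflexive)

  -- A series t stands for Σ t k zᵏ. The operators shift n, lin x, lin⁻¹ x and cyc n multiply it
  -- by zⁿ, 1 − x z, (1 − x z)⁻¹ and 1 − zⁿ; lins xs and lins⁻¹ xs by the products of these over xs.
  Operator : Set c
  Operator = Series → Series

  δ : Series
  δ zero    = 1#
  δ (suc k) = 0#

  shift : ℕ → Operator
  shift zero    t k       = t k
  shift (suc n) t zero    = 0#
  shift (suc n) t (suc k) = shift n t k

  lin : Carrier → Operator
  lin x t k = t k - x * shift 1 t k

  lin⁻¹ : Carrier → Operator
  lin⁻¹ x t zero    = t zero
  lin⁻¹ x t (suc k) = t (suc k) + x * lin⁻¹ x t k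

  cyc : ℕ → Operator
  cyc n t k = t k - shift n t k

  lins : List Carrier → Operator
  lins []       t = t
  lins (x ∷ xs) t = lin x (lins xs t)

  lins⁻¹ : List Carrier → Operator
  lins⁻¹ []       t = t
  lins⁻¹ (x ∷ xs) t = lin⁻¹ x (lins⁻¹ xs t)

  shift-cong : ∀ n → Congruent₁ _≋_ (shift n)
  shift-cong zero    e k       = e k
  shift-cong (suc n) e zero    = refl
  shift-cong (suc n) e (suc k) = shift-cong n e k

  shift-+ : ∀ m n t k → shift m (shift n t) k ≡ shift (m ℕ.+ n) t k
  shift-+ zero    n t k       = ≡-refl
  shift-+ (suc m) n t zero    = ≡-refl
  shift-+ (suc m) n t (suc k) = shift-+ m n t k

  shift-comm : ∀ m n t → shift m (shift n t) ≋ shift n (shift m t)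
  shift-comm m n t k = reflexive (≡.trans (shift-+ m n t k)
    (≡.trans (cong (λ j → shift j t k) (ℕ.+-comm m n)) (≡.sym (shift-+ n m t k))))

  shift-zipWith : ∀ (f : Carrier → Carrier → Carrier) → f 0# 0# ≈ 0# →
                  ∀ n s t k → shift n (λ i → f (s i) (t i)) k ≈ f (shift n s k) (shift n t k)
  shift-zipWith f f00 zero    s t k       = refl
  shift-zipWith f f00 (suc n) s t zero    = sym f00
  shift-zipWith f f00 (suc n) s t (suc k) = shift-zipWith f f00 n s t k

  shift-≥ : ∀ n t k → n ≤ k → shift n t k ≡ t (k ∸ n)
  shift-≥ zero    t k       _          = ≡-refl
  shift-≥ (suc n) t (suc k) (ℕ.s≤s le) = shift-≥ n t k le

  shift-< : ∀ n t k → k < n → shift n t k ≡ 0#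
  shift-< (suc n) t zero    _          = ≡-refl
  shift-< (suc n) t (suc k) (ℕ.s≤s lt) = shift-< n t k lt

  lin-cong : ∀ x → Congruent₁ _≋_ (lin x)
  lin-cong x e k = +-cong (e k) (-‿cong (*-congˡ (shift-cong 1 e k)))

  lin-congˡ : ∀ {x y} → x ≈ y → ∀ t → lin x t ≋ lin y t
  lin-congˡ x≈y t k = +-congˡ (-‿cong (*-congʳ x≈y))

  lin⁻¹-cong : ∀ x → Congruent₁ _≋_ (lin⁻¹ x)
  lin⁻¹-cong x e zero    = e zero
  lin⁻¹-cong x e (suc k) = +-cong (e (suc k)) (*-congˡ (lin⁻¹-cong x e k))

  cyc-cong : ∀ n → Congruent₁ _≋_ (cyc n)
  cyc-cong n e k = +-cong (e k) (-‿cong (shift-cong n e k))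

  lins-cong : ∀ xs → Congruent₁ _≋_ (lins xs)
  lins-cong []       e = e
  lins-cong (x ∷ xs) e = lin-cong x (lins-cong xs e)

  lins⁻¹-cong : ∀ xs → Congruent₁ _≋_ (lins⁻¹ xs)
  lins⁻¹-cong []       e = e
  lins⁻¹-cong (x ∷ xs) e = lin⁻¹-cong x (lins⁻¹-cong xs e)

  lins-map-cong : ∀ {a} {A : Set a} {f g : A → Carrier} → (∀ i → f i ≈ g i) →
                  ∀ is t → lins (map f is) t ≋ lins (map g is) t
  lins-map-cong f≈g []       t = ≋-refl
  lins-map-cong f≈g (i ∷ is) t =
    ≋-trans (lin-cong _ (lins-map-cong f≈g is t)) (lin-congˡ (f≈g i) _)

  lins-++ : ∀ xs ys t → lins (xs ++ ys) t ≋ lins xs (lins ys t)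
  lins-++ []       ys t = ≋-refl
  lins-++ (x ∷ xs) ys t = lin-cong x (lins-++ xs ys t)

  lin-lin⁻¹ : ∀ x t → lin x (lin⁻¹ x t) ≋ t
  lin-lin⁻¹ x t zero    = solve 2 (λ a x → a :- x :* con (+ 0) := a) refl (t zero) x
  lin-lin⁻¹ x t (suc k) =
    solve 3 (λ a x d → (a :+ x :* d) :- x :* d := a) refl (t (suc k)) x (lin⁻¹ x t k)

  lin⁻¹-lin : ∀ x t → lin⁻¹ x (lin x t) ≋ t
  lin⁻¹-lin x t zero    = solve 2 (λ a x → a :- x :* con (+ 0) := a) refl (t zero) x
  lin⁻¹-lin x t (suc k) = begin
    (t (suc k) - x * t k) + x * lin⁻¹ x (lin x t) k  ≈⟨ +-congˡ (*-congˡ (lin⁻¹-lin x t k)) ⟩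
    (t (suc k) - x * t k) + x * t k                  ≈⟨ solve 3 (λ a x b → (a :- x :* b) :+ x :* b := a)
                                                                refl (t (suc k)) x (t k) ⟩
    t (suc k)                                        ∎

  Commute : Operator → Operator → Set (c ⊔ ℓ)
  Commute F G = ∀ t → F (G t) ≋ G (F t)

  lin-comm : ∀ x y → Commute (lin x) (lin y)
  lin-comm x y t zero    = solve 3 (λ a x y → (a :- y :* con (+ 0)) :- x :* con (+ 0)
                                            := (a :- x :* con (+ 0)) :- y :* con (+ 0))
                                   refl (t zero) x y
  lin-comm x y t (suc k) = solve 5 (λ a b c x y → (a :- y :* b) :- x :* (b :- y :* c)
                                                := (a :- x :* b) :- y :* (b :- x :* c))
                                   refl (t (suc k)) (t k) (shift 1 t k) x y

  lin-cyc-comm : ∀ x n → Commute (lin x) (cyc n)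
  lin-cyc-comm x n t k = begin
    (tₖ - sₙ) - x * shift 1 (λ i → t i - shift n t i) k
      ≈⟨ +-congˡ (-‿cong (*-congˡ (shift-zipWith _-_ (-‿inverseʳ 0#) 1 t (shift n t) k))) ⟩
    (tₖ - sₙ) - x * (s₁ - shift 1 (shift n t) k)
      ≈⟨ +-congˡ (-‿cong (*-congˡ (+-congˡ (-‿cong (shift-comm 1 n t k))))) ⟩
    (tₖ - sₙ) - x * (s₁ - sₙ₁)
      ≈⟨ solve 5 (λ a b c d x → (a :- b) :- x :* (c :- d) := (a :- x :* c) :- (b :- x :* d))
               refl tₖ sₙ s₁ sₙ₁ x ⟩
    (tₖ - x * s₁) - (sₙ - x * sₙ₁)
      ≈⟨ +-congˡ (-‿cong (shift-zipWith (λ u v → u - x * v) 0-x0≈0 n t (shift 1 t) k)) ⟨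
    (tₖ - x * s₁) - shift n (λ i → t i - x * shift 1 t i) k
      ∎
    where
    tₖ = t k
    sₙ = shift n t k
    s₁ = shift 1 t k
    sₙ₁ = shift n (shift 1 t) k
    0-x0≈0 : 0# - x * 0# ≈ 0#
    0-x0≈0 = solve 1 (λ x → con (+ 0) :- x :* con (+ 0) := con (+ 0)) refl x

  commute-lin⁻¹ : ∀ {F} x → Congruent₁ _≋_ F → Commute F (lin x) → Commute F (lin⁻¹ x)
  commute-lin⁻¹ {F} x F-cong F∘lin t = ≋-trans (≋-sym (lin⁻¹-lin x (F (lin⁻¹ x t))))
    (lin⁻¹-cong x (≋-trans (≋-sym (F∘lin (lin⁻¹ x t))) (F-cong (lin-lin⁻¹ x t))))

  commute-lins : ∀ {F} → Congruent₁ _≋_ F → (∀ x → Commute F (lin x)) → ∀ xs → Commute F (lins xs)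
  commute-lins F-cong F∘lin []       t = ≋-refl
  commute-lins F-cong F∘lin (x ∷ xs) t =
    ≋-trans (F∘lin x _) (lin-cong x (commute-lins F-cong F∘lin xs t))

  commute-lins⁻¹ : ∀ {F} → Congruent₁ _≋_ F → (∀ x → Commute F (lin⁻¹ x)) →
                   ∀ xs → Commute F (lins⁻¹ xs)
  commute-lins⁻¹ F-cong F∘lin⁻¹ []       t = ≋-refl
  commute-lins⁻¹ F-cong F∘lin⁻¹ (x ∷ xs) t =
    ≋-trans (F∘lin⁻¹ x _) (lin⁻¹-cong x (commute-lins⁻¹ F-cong F∘lin⁻¹ xs t))

  lin-lin⁻¹-comm : ∀ x y → Commute (lin x) (lin⁻¹ y)
  lin-lin⁻¹-comm x y = commute-lin⁻¹ y (lin-cong x) (lin-comm x y)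

  lin-lins-comm : ∀ x xs → Commute (lin x) (lins xs)
  lin-lins-comm x = commute-lins (lin-cong x) (lin-comm x)

  lins⁻¹-lins : ∀ xs t → lins⁻¹ xs (lins xs t) ≋ t
  lins⁻¹-lins []       t = ≋-refl
  lins⁻¹-lins (x ∷ xs) t = ≋-trans
    (lin⁻¹-cong x (≋-sym (commute-lins⁻¹ (lin-cong x) (lin-lin⁻¹-comm x) xs (lins xs t))))
    (≋-trans (lin⁻¹-lin x _) (lins⁻¹-lins xs t))

  lins-transpose : ∀ xs {s t} → lins xs s ≋ t → s ≋ lins⁻¹ xs t
  lins-transpose xs {s} e = ≋-trans (≋-sym (lins⁻¹-lins xs s)) (lins⁻¹-cong xs e)

  cyc-lins⁻¹-comm : ∀ n xs → Commute (cyc n) (lins⁻¹ xs)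
  cyc-lins⁻¹-comm n = commute-lins⁻¹ (cyc-cong n)
    (λ x → commute-lin⁻¹ x (cyc-cong n) (λ t → ≋-sym (lin-cyc-comm x n t)))

  lins-↭ : ∀ {xs ys} → xs ↭ ys → ∀ t → lins xs t ≋ lins ys t
  lins-↭ ↭.refl            t = ≋-refl
  lins-↭ (prep x p)        t = lin-cong x (lins-↭ p t)
  lins-↭ (swap x y p)      t = ≋-trans (lin-comm x y _) (lin-cong y (lin-cong x (lins-↭ p t)))
  lins-↭ (↭.trans p q)     t = ≋-trans (lins-↭ p t) (lins-↭ q t)

  shift-δ-self : ∀ n → shift n δ n ≈ 1#
  shift-δ-self zero    = refl
  shift-δ-self (suc n) = shift-δ-self n

  shift-δ-other : ∀ n k → k ≢ n → shift n δ k ≈ 0#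
  shift-δ-other zero    zero    k≢n = contradiction ≡-refl k≢n
  shift-δ-other zero    (suc k) _   = refl
  shift-δ-other (suc n) zero    _   = refl
  shift-δ-other (suc n) (suc k) k≢n = shift-δ-other n k (k≢n ∘ cong suc)

  lin⁻¹-1-sparse : ∀ t k → (∀ i → 0 < i → i ≤ k → t i ≈ 0#) → lin⁻¹ 1# t k ≈ t 0
  lin⁻¹-1-sparse t zero    _   = refl
  lin⁻¹-1-sparse t (suc k) t≈0 = begin
    t (suc k) + 1# * lin⁻¹ 1# t k  ≈⟨ +-cong (t≈0 (suc k) ℕ.z<s ℕ.≤-refl) (*-congˡ (lin⁻¹-1-sparse t k t≈0′)) ⟩
    0# + 1# * t 0                  ≈⟨ solve 1 (λ u → con (+ 0) :+ con (+ 1) :* u := u) refl (t 0) ⟩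
    t 0                            ∎
    where
    t≈0′ : ∀ i → 0 < i → i ≤ k → t i ≈ 0#
    t≈0′ i 0<i i≤k = t≈0 i 0<i (ℕ.m≤n⇒m≤1+n i≤k)

  conv : Series → Operator
  conv s t zero    = s 0 * t 0
  conv s t (suc k) = s 0 * t (suc k) + conv (s ∘ suc) t k

  conv-congˡ : ∀ {s s′} t → s ≋ s′ → conv s t ≋ conv s′ t
  conv-congˡ t e zero    = *-congʳ (e 0)
  conv-congˡ t e (suc k) = +-cong (*-congʳ (e 0)) (conv-congˡ t (e ∘ suc) k)

  conv-zeroˡ : ∀ {s} t → (∀ i → s i ≈ 0#) → ∀ k → conv s t k ≈ 0#
  conv-zeroˡ t s≈0 zero    = trans (*-congʳ (s≈0 0)) (zeroˡ _)
  conv-zeroˡ t s≈0 (suc k) =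
    trans (+-cong (trans (*-congʳ (s≈0 0)) (zeroˡ _)) (conv-zeroˡ t (s≈0 ∘ suc) k)) (+-identityˡ 0#)

  conv-δ : ∀ t → conv δ t ≋ t
  conv-δ t zero    = *-identityˡ _
  conv-δ t (suc k) = trans (+-cong (*-identityˡ _) (conv-zeroˡ t (λ _ → refl) k)) (+-identityʳ _)

  conv-sub : ∀ s s′ t k → conv (λ i → s i - s′ i) t k ≈ conv s t k - conv s′ t k
  conv-sub s s′ t zero    = solve 3 (λ a b u → (a :- b) :* u := a :* u :- b :* u) refl (s 0) (s′ 0) (t 0)
  conv-sub s s′ t (suc k) = trans (+-congˡ (conv-sub (s ∘ suc) (s′ ∘ suc) t k))
    (solve 5 (λ a b u v w → (a :- b) :* u :+ (v :- w) := (a :* u :+ v) :- (b :* u :+ w))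
           refl (s 0) (s′ 0) (t (suc k)) _ _)

  conv-sub-* : ∀ x s s′ t k → conv (λ i → s i - x * s′ i) t k ≈ conv s t k - x * conv s′ t k
  conv-sub-* x s s′ t zero    =
    solve 4 (λ x a b u → (a :- x :* b) :* u := a :* u :- x :* (b :* u)) refl x (s 0) (s′ 0) (t 0)
  conv-sub-* x s s′ t (suc k) = trans (+-congˡ (conv-sub-* x (s ∘ suc) (s′ ∘ suc) t k))
    (solve 6 (λ x a b u v w → (a :- x :* b) :* u :+ (v :- x :* w) := (a :* u :+ v) :- x :* (b :* u :+ w))
           refl x (s 0) (s′ 0) (t (suc k)) _ _)

  conv-shift : ∀ n s t → conv (shift n s) t ≋ shift n (conv s t)
  conv-shift zero    s t k       = refl
  conv-shift (suc n) s t zero    = zeroˡ _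
  conv-shift (suc n) s t (suc k) = begin
    0# * t (suc k) + conv (shift n s) t k  ≈⟨ +-congʳ (zeroˡ _) ⟩
    0# + conv (shift n s) t k              ≈⟨ +-identityˡ _ ⟩
    conv (shift n s) t k                   ≈⟨ conv-shift n s t k ⟩
    shift n (conv s t) k                   ∎

  conv-lin : ∀ x s t → conv (lin x s) t ≋ lin x (conv s t)
  conv-lin x s t k = trans (conv-sub-* x s (shift 1 s) t k) (+-congˡ (-‿cong (*-congˡ (conv-shift 1 s t k))))

  conv-cyc : ∀ n s t → conv (cyc n s) t ≋ cyc n (conv s t)
  conv-cyc n s t k = trans (conv-sub s (shift n s) t k) (+-congˡ (-‿cong (conv-shift n s t k)))

  lins≋conv : ∀ xs t → lins xs t ≋ conv (lins xs δ) t
  lins≋conv []       t = ≋-sym (conv-δ t)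
  lins≋conv (x ∷ xs) t = ≋-trans (lin-cong x (lins≋conv xs t)) (≋-sym (conv-lin x (lins xs δ) t))

  cyc≋conv : ∀ n t → cyc n t ≋ conv (cyc n δ) t
  cyc≋conv n t = ≋-trans (cyc-cong n (≋-sym (conv-δ t))) (≋-sym (conv-cyc n δ t))

  lins≋cyc : ∀ xs n → lins xs δ ≋ cyc n δ → ∀ t → lins xs t ≋ cyc n t
  lins≋cyc xs n e t = ≋-trans (lins≋conv xs t) (≋-trans (conv-congˡ t e) (≋-sym (cyc≋conv n t)))

  lins-at-0 : ∀ xs t → lins xs t 0 ≈ t 0
  lins-at-0 []       t = refl
  lins-at-0 (x ∷ xs) t =
    trans (solve 2 (λ a x → a :- x :* con (+ 0) := a) refl _ x) (lins-at-0 xs t)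

  lins-δ-degree : ∀ xs k → length xs < k → lins xs δ k ≈ 0#
  lins-δ-degree []       (suc k) _          = refl
  lins-δ-degree (x ∷ xs) (suc k) (ℕ.s≤s lt) = begin
    lins xs δ (suc k) - x * lins xs δ k  ≈⟨ +-cong (lins-δ-degree xs (suc k) (ℕ.m≤n⇒m≤1+n lt))
                                                   (-‿cong (*-congˡ (lins-δ-degree xs k lt))) ⟩
    0# - x * 0#                          ≈⟨ solve 1 (λ x → con (+ 0) :- x :* con (+ 0) := con (+ 0)) refl x ⟩
    0#                                   ∎

  scale : Carrier → Operator
  scale a t k = pow a k * t k

  scale-δ : ∀ a → scale a δ ≋ δ
  scale-δ a zero    = *-identityˡ 1#
  scale-δ a (suc k) = zeroʳ _

  scale-lin : ∀ a x t → scale a (lin x t) ≋ lin (x * a) (scale a t)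
  scale-lin a x t zero    = solve 3 (λ a u x → con (+ 1) :* (u :- x :* con (+ 0))
                                            := con (+ 1) :* u :- (x :* a) :* con (+ 0))
                                    refl a (t 0) x
  scale-lin a x t (suc k) = solve 5 (λ a aᵏ u v x → (a :* aᵏ) :* (v :- x :* u)
                                                 := (a :* aᵏ) :* v :- (x :* a) :* (aᵏ :* u))
                                    refl a (pow a k) (t k) (t (suc k)) x

  scale-lins : ∀ a xs t → scale a (lins xs t) ≋ lins (map (_* a) xs) (scale a t)
  scale-lins a []       t = ≋-refl
  scale-lins a (x ∷ xs) t = ≋-trans (scale-lin a x (lins xs t)) (lin-cong (x * a) (scale-lins a xs t))

  Σ-cong : ∀ {f g : ℕ → Carrier} → (∀ i → f i ≈ g i) → ∀ is →
           foldr _+_ 0# (map f is) ≈ foldr _+_ 0# (map g is)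
  Σ-cong f≈g []       = refl
  Σ-cong f≈g (i ∷ is) = +-cong (f≈g i) (Σ-cong f≈g is)

  Σ-*ˡ : ∀ x (f : ℕ → Carrier) is → foldr _+_ 0# (map (λ i → x * f i) is) ≈ x * foldr _+_ 0# (map f is)
  Σ-*ˡ x f []       = sym (zeroʳ x)
  Σ-*ˡ x f (i ∷ is) = trans (+-congˡ (Σ-*ˡ x f is)) (sym (distribˡ x _ _))

  Σ≈lin⁻¹ : ∀ x t k → foldr _+_ 0# (map (λ i → pow x i * t (k ∸ i)) (upTo (suc k))) ≈ lin⁻¹ x t k
  Σ≈lin⁻¹ x t zero    = trans (+-identityʳ _) (*-identityˡ _)
  Σ≈lin⁻¹ x t (suc k) = +-cong (*-identityˡ _) (begin
    foldr _+_ 0# (map f (applyUpTo suc (suc k)))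
      ≡⟨ cong (foldr _+_ 0#) (≡.trans (List.map-applyUpTo suc f (suc k))
                                      (≡.sym (List.map-applyUpTo (λ i → i) (f ∘ suc) (suc k)))) ⟩
    foldr _+_ 0# (map (f ∘ suc) (upTo (suc k)))
      ≈⟨ Σ-cong (λ i → *-assoc x (pow x i) (t (k ∸ i))) (upTo (suc k)) ⟩
    foldr _+_ 0# (map (λ i → x * (pow x i * t (k ∸ i))) (upTo (suc k)))
      ≈⟨ Σ-*ˡ x _ (upTo (suc k)) ⟩
    x * foldr _+_ 0# (map (λ i → pow x i * t (k ∸ i)) (upTo (suc k)))
      ≈⟨ *-congˡ (Σ≈lin⁻¹ x t k) ⟩
    x * lin⁻¹ x t k
      ∎)
    where
    f : ℕ → Carrier
    f i = pow x i * t (suc k ∸ i)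

  H≈lins⁻¹ : ∀ xs k → H k xs ≈ lins⁻¹ xs δ k
  H≈lins⁻¹ []       zero    = refl
  H≈lins⁻¹ []       (suc k) = refl
  H≈lins⁻¹ (x ∷ xs) zero    =
    trans (Σ≈lin⁻¹ x (λ j → H j xs) zero) (lin⁻¹-cong x (H≈lins⁻¹ xs) zero)
  H≈lins⁻¹ (x ∷ xs) (suc k) =
    trans (Σ≈lin⁻¹ x (λ j → H j xs) (suc k)) (lin⁻¹-cong x (H≈lins⁻¹ xs) (suc k))

module LinearFactors {c ℓ} (R : CommutativeRing c ℓ) where
  open CommutativeRing R hiding (zero)
  open Poly R using (Pol; _+ₚ_; _*ₚ_; coeff; cyclotomic; pow)
  open PowerSeries R
  open IntegerCoefficients R
  open import Relation.Binary.Reasoning.Setoid setoid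

  linearFactors : List Carrier → Pol
  linearFactors = foldr (λ y g → (- y ∷ 1# ∷ []) *ₚ g) (1# ∷ [])

  cyclotomic≡linearFactors : ∀ ω n → cyclotomic ω n ≡ linearFactors (map (pow ω) (coprimesUpTo n))
  cyclotomic≡linearFactors ω n = ≡.sym (List.foldr-map _ (pow ω) (1# ∷ []) (coprimesUpTo n))

  coeff-+ₚ : ∀ f g i → coeff (f +ₚ g) i ≈ coeff f i + coeff g i
  coeff-+ₚ []      g       i       = sym (+-identityˡ _)
  coeff-+ₚ (a ∷ f) []      zero    = sym (+-identityʳ _)
  coeff-+ₚ (a ∷ f) []      (suc i) = sym (+-identityʳ _)
  coeff-+ₚ (a ∷ f) (b ∷ g) zero    = refl
  coeff-+ₚ (a ∷ f) (b ∷ g) (suc i) = coeff-+ₚ f g i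

  coeff-map-* : ∀ a g i → coeff (map (a *_) g) i ≈ a * coeff g i
  coeff-map-* a []      i       = sym (zeroʳ a)
  coeff-map-* a (b ∷ g) zero    = refl
  coeff-map-* a (b ∷ g) (suc i) = coeff-map-* a g i

  coeff-[0] : ∀ i → coeff (0# ∷ []) i ≈ 0#
  coeff-[0] zero    = refl
  coeff-[0] (suc i) = refl

  coeff-linear-0 : ∀ a g → coeff ((a ∷ 1# ∷ []) *ₚ g) 0 ≈ a * coeff g 0
  coeff-linear-0 a g = trans (coeff-+ₚ (map (a *_) g) _ 0) (trans (+-identityʳ _) (coeff-map-* a g 0))

  coeff-linear-suc : ∀ a g i → coeff ((a ∷ 1# ∷ []) *ₚ g) (suc i) ≈ a * coeff g (suc i) + coeff g i
  coeff-linear-suc a g i = begin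
    coeff ((a ∷ 1# ∷ []) *ₚ g) (suc i)
      ≈⟨ coeff-+ₚ (map (a *_) g) _ (suc i) ⟩
    coeff (map (a *_) g) (suc i) + coeff (map (1# *_) g +ₚ (0# ∷ [])) i
      ≈⟨ +-cong (coeff-map-* a g (suc i)) (coeff-+ₚ (map (1# *_) g) (0# ∷ []) i) ⟩
    a * coeff g (suc i) + (coeff (map (1# *_) g) i + coeff (0# ∷ []) i)
      ≈⟨ +-congˡ (+-cong (coeff-map-* 1# g i) (coeff-[0] i)) ⟩
    a * coeff g (suc i) + (1# * coeff g i + 0#)
      ≈⟨ +-congˡ (trans (+-identityʳ _) (*-identityˡ _)) ⟩
    a * coeff g (suc i) + coeff g i
      ∎

  linearFactors-degree : ∀ ys i → length ys < i → coeff (linearFactors ys) i ≈ 0#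
  linearFactors-degree []       (suc i) _          = refl
  linearFactors-degree (y ∷ ys) (suc i) (ℕ.s≤s lt) = begin
    coeff ((- y ∷ 1# ∷ []) *ₚ g) (suc i)    ≈⟨ coeff-linear-suc (- y) g i ⟩
    - y * coeff g (suc i) + coeff g i       ≈⟨ +-cong (*-congˡ (linearFactors-degree ys (suc i) (ℕ.m≤n⇒m≤1+n lt)))
                                                      (linearFactors-degree ys i lt) ⟩
    - y * 0# + 0#                           ≈⟨ solve 1 (λ y → :- y :* con (+ 0) :+ con (+ 0) := con (+ 0)) refl y ⟩
    0#                                      ∎
    where g = linearFactors ys

  coeff-linearFactors : ∀ ys i k → i ℕ.+ k ≡ length ys → coeff (linearFactors ys) i ≈ lins ys δ k
  coeff-linearFactors []       zero    zero    _     = refl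
  coeff-linearFactors (y ∷ ys) zero    k       ≡-refl = begin
    coeff ((- y ∷ 1# ∷ []) *ₚ g) 0  ≈⟨ coeff-linear-0 (- y) g ⟩
    - y * coeff g 0                 ≈⟨ *-congˡ (coeff-linearFactors ys 0 (length ys) ≡-refl) ⟩
    - y * t (length ys)             ≈⟨ solve 2 (λ y u → :- y :* u := con (+ 0) :- y :* u) refl y _ ⟩
    0# - y * t (length ys)          ≈⟨ +-congʳ (lins-δ-degree ys (suc (length ys)) ℕ.≤-refl) ⟨
    lins (y ∷ ys) δ (suc (length ys)) ∎
    where
    g = linearFactors ys
    t = lins ys δ
  coeff-linearFactors (y ∷ ys) (suc i) zero    eq    = begin
    coeff ((- y ∷ 1# ∷ []) *ₚ g) (suc i)  ≈⟨ coeff-linear-suc (- y) g i ⟩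
    - y * coeff g (suc i) + coeff g i     ≈⟨ +-cong (*-congˡ (linearFactors-degree ys (suc i) m<1+i))
                                                    (coeff-linearFactors ys i 0 i+0≡m) ⟩
    - y * 0# + t 0                        ≈⟨ solve 2 (λ y u → :- y :* con (+ 0) :+ u := u :- y :* con (+ 0)) refl y _ ⟩
    t 0 - y * 0#                          ∎
    where
    g = linearFactors ys
    t = lins ys δ
    i+0≡m : i ℕ.+ 0 ≡ length ys
    i+0≡m = ℕ.suc-injective eq
    m<1+i : length ys < suc i
    m<1+i = ℕ.s≤s (ℕ.≤-reflexive (≡.trans (≡.sym i+0≡m) (ℕ.+-identityʳ i)))
  coeff-linearFactors (y ∷ ys) (suc i) (suc k) eq    = begin
    coeff ((- y ∷ 1# ∷ []) *ₚ g) (suc i)  ≈⟨ coeff-linear-suc (- y) g i ⟩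
    - y * coeff g (suc i) + coeff g i     ≈⟨ +-cong (*-congˡ (coeff-linearFactors ys (suc i) k
                                                                (≡.trans (≡.sym (ℕ.+-suc i k)) (ℕ.suc-injective eq))))
                                                    (coeff-linearFactors ys i (suc k) (ℕ.suc-injective eq)) ⟩
    - y * t k + t (suc k)                 ≈⟨ solve 3 (λ y u v → :- y :* u :+ v := v :- y :* u) refl y _ _ ⟩
    t (suc k) - y * t k                   ∎
    where
    g = linearFactors ys
    t = lins ys δ

module RootsOfUnity {c ℓ} (R : CommutativeRing c ℓ) where
  open CommutativeRing R hiding (zero)
  open Poly R using (pow)
  open PowerSeries R
  open IntegerCoefficients R
  open import Algebra.Properties.Semiring.Exp semiring using (_^_; ^-assocʳ)
  open import Algebra.Properties.Ring ring using (x∙y⁻¹≈ε⇒x≈y)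
  open import Relation.Binary.Reasoning.Setoid setoid

  NoZeroDivisors : Set (c ⊔ ℓ)
  NoZeroDivisors = ∀ x y → x * y ≈ 0# → x ≈ 0# ⊎ y ≈ 0#

  IsPrimitiveRoot : Carrier → ℕ → Set ℓ
  IsPrimitiveRoot ζ n = pow ζ n ≈ 1# × (∀ d → 0 < d → d < n → ¬ pow ζ d ≈ 1#)

  pow≡^ : ∀ x n → pow x n ≡ x ^ n
  pow≡^ x zero    = ≡-refl
  pow≡^ x (suc n) = cong (x *_) (pow≡^ x n)

  pow-* : ∀ x m n → pow x (m ℕ.* n) ≈ pow (pow x m) n
  pow-* x m n = begin
    pow x (m ℕ.* n)  ≡⟨ pow≡^ x (m ℕ.* n) ⟩
    x ^ (m ℕ.* n)    ≈⟨ ^-assocʳ x m n ⟨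
    (x ^ m) ^ n      ≡⟨ ≡.trans (pow≡^ (pow x m) n) (cong (_^ n) (pow≡^ x m)) ⟨
    pow (pow x m) n  ∎

  pow-primitive : ∀ {ω} m n → 0 < m → IsPrimitiveRoot ω (m ℕ.* n) → IsPrimitiveRoot (pow ω m) n
  pow-primitive {ω} m n 0<m (ωᵐⁿ≈1 , ω-prim) = trans (sym (pow-* ω m n)) ωᵐⁿ≈1 , ωᵐ-primitive
    where
    instance _ = ℕ.>-nonZero 0<m
    ωᵐ-primitive : ∀ d → 0 < d → d < n → ¬ pow (pow ω m) d ≈ 1#
    ωᵐ-primitive d 0<d d<n ωᵐᵈ≈1 =
      ω-prim (m ℕ.* d) (ℕ.*-mono-< 0<m 0<d) (ℕ.*-monoʳ-< m d<n) (trans (pow-* ω m d) ωᵐᵈ≈1)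

  roots : Carrier → ℕ → List Carrier
  roots ζ n = map (pow ζ) (upTo n)

  powers : Carrier → ℕ → List Carrier
  powers ζ n = map (pow ζ) (applyUpTo suc n)

  lins-powers≋roots : ∀ {ζ} m → pow ζ (suc m) ≈ 1# →
                      ∀ t → lins (powers ζ (suc m)) t ≋ lins (roots ζ (suc m)) t
  lins-powers≋roots {ζ} m ζⁿ≈1 t = ≋-trans (lins-↭ rotate t) (lin-congˡ ζⁿ≈1 _)
    where
    rotate : powers ζ (suc m) ↭ pow ζ (suc m) ∷ powers ζ m
    rotate = ↭.↭-trans
      (↭.↭-reflexive (≡.trans (cong (map (pow ζ)) (≡.sym (List.applyUpTo-∷ʳ suc m)))
                              (List.map-++ (pow ζ) (applyUpTo suc m) (suc m ∷ []))))
      (↭.↭-sym (↭.∷↭∷ʳ (pow ζ (suc m)) (powers ζ m)))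

  lins-scaled-roots : ∀ ζ n t → lins (map (_* ζ) (roots ζ n)) t ≋ lins (powers ζ n) t
  lins-scaled-roots ζ n t = ≋-trans
    (≋-reflexive (cong (λ xs → lins xs t) (≡.sym (List.map-∘ (upTo n)))))
    (≋-trans (lins-map-cong (λ i → *-comm (pow ζ i) ζ) (upTo n) t)
             (≋-reflexive (cong (λ xs → lins xs t)
                                (≡.trans (List.map-∘ (upTo n)) (cong (map (pow ζ)) (List.map-upTo suc n))))))

  module _ (noZeroDivisors : NoZeroDivisors) where

    ax≈x⇒x≈0 : ∀ {a x} → ¬ a ≈ 1# → a * x ≈ x → x ≈ 0#
    ax≈x⇒x≈0 {a} {x} a≉1 ax≈x with noZeroDivisors (a - 1#) x [a-1]x≈0
      where
      [a-1]x≈0 : (a - 1#) * x ≈ 0#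
      [a-1]x≈0 = begin
        (a - 1#) * x  ≈⟨ solve 2 (λ a x → (a :- con (+ 1)) :* x := a :* x :- x) refl a x ⟩
        a * x - x     ≈⟨ +-congʳ ax≈x ⟩
        x - x         ≈⟨ -‿inverseʳ x ⟩
        0#            ∎
    ... | inj₁ a-1≈0 = contradiction (x∙y⁻¹≈ε⇒x≈y a 1# a-1≈0) a≉1
    ... | inj₂ x≈0   = x≈0

    -- P = ∏_{j<n} (1 − ζʲ z) is invariant under z ↦ ζ z, so ζᵏ Pₖ = Pₖ forces Pₖ = 0 for 0 < k < n.
    -- As P = (1 − z) Q with deg Q < n, the coefficients of P sum to Qₙ = 0, whence Pₙ = −1.
    lins-roots-δ : ∀ {ζ} m → IsPrimitiveRoot ζ (suc m) → lins (roots ζ (suc m)) δ ≋ cyc (suc m) δ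
    lins-roots-δ {ζ} m (ζⁿ≈1 , ζ-prim) = P≋cyc
      where
      n = suc m
      P = lins (roots ζ n) δ
      Q = lins (powers ζ m) δ

      P-invariant : scale ζ P ≋ P
      P-invariant = ≋-trans (scale-lins ζ (roots ζ n) δ)
        (≋-trans (lins-cong (map (_* ζ) (roots ζ n)) (scale-δ ζ))
        (≋-trans (lins-scaled-roots ζ n δ) (lins-powers≋roots m ζⁿ≈1 δ)))

      P-middle : ∀ k → 0 < k → k < n → P k ≈ 0#
      P-middle k 0<k k<n = ax≈x⇒x≈0 (ζ-prim k 0<k k<n) (P-invariant k)

      P-high : ∀ k → n < k → P k ≈ 0#
      P-high k n<k = lins-δ-degree (roots ζ n) k
        (≡.subst (_< k) (≡.sym (≡.trans (List.length-map (pow ζ) (upTo n)) (List.length-upTo n))) n<k)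

      P-top : P n ≈ - 1#
      P-top = begin
        P n                             ≈⟨ solve 1 (λ u → u := (u :+ con (+ 1) :* con (+ 1)) :- con (+ 1)) refl (P n) ⟩
        (P n + 1# * 1#) - 1#            ≈⟨ +-congʳ (+-congˡ (*-congˡ ΣP≈1)) ⟨
        (P n + 1# * lin⁻¹ 1# P m) - 1#  ≈⟨ +-congʳ (lin⁻¹-lin 1# Q n) ⟩
        Q n - 1#                        ≈⟨ +-congʳ (lins-δ-degree (powers ζ m) n Q-degree) ⟩
        0# - 1#                         ≈⟨ +-identityˡ _ ⟩
        - 1#                            ∎
        where
        ΣP≈1 : lin⁻¹ 1# P m ≈ 1#
        ΣP≈1 = trans (lin⁻¹-1-sparse P m (λ i 0<i i≤m → P-middle i 0<i (ℕ.s≤s i≤m))) (lins-at-0 (roots ζ n) δ)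
        Q-degree : length (powers ζ m) < n
        Q-degree = ℕ.s≤s (ℕ.≤-reflexive
          (≡.trans (List.length-map (pow ζ) (applyUpTo suc m)) (List.length-applyUpTo suc m)))

      P≋cyc : P ≋ cyc n δ
      P≋cyc zero    = trans (lins-at-0 (roots ζ n) δ) (solve 0 (con (+ 1) := con (+ 1) :- con (+ 0)) refl)
      P≋cyc (suc k) with ℕ.<-cmp (suc k) n
      ... | tri< k<n k≢n _ = trans (P-middle (suc k) ℕ.z<s k<n)
                                   (trans (sym (-‿inverseʳ 0#)) (+-congˡ (-‿cong (sym (shift-δ-other n (suc k) k≢n)))))
      ... | tri≈ _ ≡-refl _ = trans P-top (trans (sym (+-identityˡ _)) (+-congˡ (-‿cong (sym (shift-δ-self n)))))
      ... | tri> _ k≢n n<k = trans (P-high (suc k) n<k)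
                                   (trans (sym (-‿inverseʳ 0#)) (+-congˡ (-‿cong (sym (shift-δ-other n (suc k) k≢n)))))

    lins-roots : ∀ {ζ} n .{{_ : ℕ.NonZero n}} → IsPrimitiveRoot ζ n →
                 ∀ t → lins (1# ∷ powers ζ (n ∸ 1)) t ≋ cyc n t
    lins-roots {ζ} (suc m) ζ-prim = lins≋cyc (roots ζ (suc m)) (suc m) (lins-roots-δ m ζ-prim)

    lins-powers : ∀ {ζ} n .{{_ : ℕ.NonZero n}} → IsPrimitiveRoot ζ n → ∀ t → lins (powers ζ n) t ≋ cyc n t
    lins-powers (suc m) ζ-prim t = ≋-trans (lins-powers≋roots m (proj₁ ζ-prim) t) (lins-roots (suc m) ζ-prim t)

module NumberTheory where
  open import Data.List.Base using (filter; [_])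
  open import Data.List.Relation.Unary.All.Properties using (applyUpTo⁺₁; map⁺)
  open import Data.List.Relation.Unary.Any.Properties using (applyUpTo⁺)
  open import Data.Nat.Coprimality using (Coprime; coprime-divisor; coprime⇒gcd≡1; gcd≡1⇒coprime)
  open import Data.Nat.Divisibility
  open import Data.Nat.GCD using (gcd)
  open import Data.Nat.Tactic.RingSolver using (solve)
  open import Relation.Unary using (Pred; Decidable; _≐_)
  open import Relation.Unary.Properties using (∁?; _∩?_)
  open import Relation.Binary.PropositionalEquality.Properties using (module ≡-Reasoning)
  open ≡-Reasoning

  private variable a ℓ : Level

  multiples : ℕ → ℕ → List ℕ
  multiples d k = map (d ℕ.*_) (applyUpTo suc k)

  multiples-suc : ∀ d k → multiples d (suc k) ≡ multiples d k ++ [ d ℕ.* suc k ]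
  multiples-suc d k = ≡.trans (cong (map (d ℕ.*_)) (≡.sym (List.applyUpTo-∷ʳ suc k)))
                              (List.map-++ (d ℕ.*_) (applyUpTo suc k) [ suc k ])

  applyUpTo-+ : ∀ {A : Set a} (f : ℕ → A) m n →
                applyUpTo f (m ℕ.+ n) ≡ applyUpTo f m ++ applyUpTo (λ i → f (m ℕ.+ i)) n
  applyUpTo-+ f zero    n = ≡-refl
  applyUpTo-+ f (suc m) n = cong (f 0 ∷_) (applyUpTo-+ (f ∘ suc) m n)

  ↭-filter-partition : ∀ {A : Set a} {P : Pred A ℓ} (P? : Decidable P) xs →
                       xs ↭ filter P? xs ++ filter (∁? P?) xs
  ↭-filter-partition P? []       = ↭.refl
  ↭-filter-partition P? (x ∷ xs) with P? x
  ... | yes _ = prep x (↭-filter-partition P? xs)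
  ... | no  _ = ↭.↭-trans (prep x (↭-filter-partition P? xs)) (↭.↭-sym (↭.shift x _ _))

  filter-filter : ∀ {A : Set a} {P Q : Pred A ℓ} (P? : Decidable P) (Q? : Decidable Q) xs →
                  filter P? (filter Q? xs) ≡ filter (P? ∩? Q?) xs
  filter-filter P? Q? []       = ≡-refl
  filter-filter P? Q? (x ∷ xs) with Q? x
  ... | no  _ with P? x
  ...   | yes _ = filter-filter P? Q? xs
  ...   | no  _ = filter-filter P? Q? xs
  filter-filter P? Q? (x ∷ xs) | yes _ with P? x
  ...   | yes _ = cong (x ∷_) (filter-filter P? Q? xs)
  ...   | no  _ = filter-filter P? Q? xs

  filter-comm : ∀ {A : Set a} {P Q : Pred A ℓ} (P? : Decidable P) (Q? : Decidable Q) xs →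
                filter P? (filter Q? xs) ≡ filter Q? (filter P? xs)
  filter-comm P? Q? xs = begin
    filter P? (filter Q? xs)  ≡⟨ filter-filter P? Q? xs ⟩
    filter (P? ∩? Q?) xs      ≡⟨ List.filter-≐ (P? ∩? Q?) (Q? ∩? P?) (×.swap , ×.swap) xs ⟩
    filter (Q? ∩? P?) xs      ≡⟨ filter-filter Q? P? xs ⟨
    filter Q? (filter P? xs)  ∎

  filter-∣-block : ∀ d k .{{_ : ℕ.NonZero d}} →
                   filter (d ∣?_) (applyUpTo (λ i → suc (k ℕ.* d ℕ.+ i)) d) ≡ [ d ℕ.* suc k ]
  filter-∣-block (suc d) k = begin
    filter (suc d ∣?_) (applyUpTo f (suc d))               ≡⟨ cong (filter (suc d ∣?_)) (List.applyUpTo-∷ʳ f d) ⟨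
    filter (suc d ∣?_) (applyUpTo f d ++ [ f d ])          ≡⟨ List.filter-++ (suc d ∣?_) (applyUpTo f d) [ f d ] ⟩
    filter (suc d ∣?_) (applyUpTo f d) ++ filter (suc d ∣?_) [ f d ]
      ≡⟨ cong₂ _++_ (List.filter-none (suc d ∣?_) (applyUpTo⁺₁ f d f-not-multiple))
                    (List.filter-accept (suc d ∣?_) f-multiple) ⟩
    [ f d ]                                                ≡⟨ cong [_] last ⟩
    [ suc d ℕ.* suc k ]                                    ∎
    where
    f : ℕ → ℕ
    f i = suc (k ℕ.* suc d ℕ.+ i)
    last : suc (k ℕ.* suc d ℕ.+ d) ≡ suc d ℕ.* suc k
    last = solve (k ∷ d ∷ [])
    f-multiple : suc d ∣ f d
    f-multiple = ≡.subst (suc d ∣_) (≡.sym last) (m∣m*n (suc k))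
    f-not-multiple : ∀ {i} → i < d → ¬ suc d ∣ f i
    f-not-multiple {i} i<d d∣fi =
      ℕ.<⇒≱ (ℕ.s≤s i<d) (∣⇒≤ (∣m+n∣m⇒∣n (≡.subst (suc d ∣_) (≡.sym (ℕ.+-suc _ i)) d∣fi) (n∣m*n k)))

  filter-∣-upTo : ∀ d k .{{_ : ℕ.NonZero d}} → filter (d ∣?_) (applyUpTo suc (k ℕ.* d)) ≡ multiples d k
  filter-∣-upTo d zero    = ≡-refl
  filter-∣-upTo d (suc k) = begin
    filter (d ∣?_) (applyUpTo suc (d ℕ.+ k ℕ.* d))
      ≡⟨ cong (λ n → filter (d ∣?_) (applyUpTo suc n)) (ℕ.+-comm d (k ℕ.* d)) ⟩
    filter (d ∣?_) (applyUpTo suc (k ℕ.* d ℕ.+ d))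
      ≡⟨ cong (filter (d ∣?_)) (applyUpTo-+ suc (k ℕ.* d) d) ⟩
    filter (d ∣?_) (applyUpTo suc (k ℕ.* d) ++ applyUpTo (λ i → suc (k ℕ.* d ℕ.+ i)) d)
      ≡⟨ List.filter-++ (d ∣?_) (applyUpTo suc (k ℕ.* d)) _ ⟩
    filter (d ∣?_) (applyUpTo suc (k ℕ.* d)) ++ filter (d ∣?_) (applyUpTo (λ i → suc (k ℕ.* d ℕ.+ i)) d)
      ≡⟨ cong₂ _++_ (filter-∣-upTo d k) (filter-∣-block d k) ⟩
    multiples d k ++ [ d ℕ.* suc k ]
      ≡⟨ multiples-suc d k ⟨
    multiples d (suc k)
      ∎

  prime∤prime : ∀ {p q} → Prime p → Prime q → p ≢ q → ¬ p ∣ q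
  prime∤prime pp pq p≢q p∣q with prime⇒irreducible pq p∣q
  ... | inj₁ ≡-refl = ¬prime[1] pp
  ... | inj₂ p≡q    = p≢q p≡q

  ∤⇒coprime : ∀ {p n} → Prime p → ¬ p ∣ n → Coprime n p
  ∤⇒coprime pp p∤n (d∣n , d∣p) with prime⇒irreducible pp d∣p
  ... | inj₁ d≡1    = d≡1
  ... | inj₂ ≡-refl = contradiction d∣n p∤n

  coprime-pq : ∀ {p q} → Prime p → Prime q →
               (λ j → ¬ q ∣ j × ¬ p ∣ j) ≐ (λ j → gcd j (p ℕ.* q) ≡ 1)
  coprime-pq {p} {q} pp pq = (λ (q∤j , p∤j) → coprime⇒gcd≡1 (coprime q∤j p∤j)) , λ g → ∤ g
    where
    coprime : ∀ {j} → ¬ q ∣ j → ¬ p ∣ j → Coprime j (p ℕ.* q)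
    coprime q∤j p∤j {d} (d∣j , d∣pq) with prime⇒irreducible pq
      (coprime-divisor (∤⇒coprime pp (λ p∣d → p∤j (∣-trans p∣d d∣j))) d∣pq)
    ... | inj₁ d≡1    = d≡1
    ... | inj₂ ≡-refl = contradiction d∣j q∤j
    ∤ : ∀ {j} → gcd j (p ℕ.* q) ≡ 1 → ¬ q ∣ j × ¬ p ∣ j
    ∤ g = (λ q∣j → ¬prime[1] (≡.subst Prime (gcd≡1⇒coprime g (q∣j , n∣m*n p)) pq))
        , (λ p∣j → ¬prime[1] (≡.subst Prime (gcd≡1⇒coprime g (p∣j , m∣m*n q)) pp))

  filter-∤-multiples : ∀ {p q} → Prime p → Prime q → p ≢ q →
                       filter (∁? (p ∣?_)) (multiples q p) ≡ multiples q (p ∸ 1)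
  filter-∤-multiples {zero}  () _ _
  filter-∤-multiples {suc p} {q} pp pq p≢q = begin
    filter (∁? (suc p ∣?_)) (multiples q (suc p))
      ≡⟨ cong (filter (∁? (suc p ∣?_))) (multiples-suc q p) ⟩
    filter (∁? (suc p ∣?_)) (multiples q p ++ [ q ℕ.* suc p ])
      ≡⟨ List.filter-++ (∁? (suc p ∣?_)) (multiples q p) _ ⟩
    filter (∁? (suc p ∣?_)) (multiples q p) ++ filter (∁? (suc p ∣?_)) [ q ℕ.* suc p ]
      ≡⟨ cong₂ _++_ (List.filter-all (∁? (suc p ∣?_)) (map⁺ (applyUpTo⁺₁ suc p p∤qi)))
                    (List.filter-reject (∁? (suc p ∣?_)) (λ p∤ → p∤ (n∣m*n q))) ⟩
    multiples q p ++ []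
      ≡⟨ List.++-identityʳ _ ⟩
    multiples q p
      ∎
    where
    p∤qi : ∀ {i} → i < p → ¬ suc p ∣ q ℕ.* suc i
    p∤qi i<p p∣qi with euclidsLemma q _ pp p∣qi
    ... | inj₁ p∣q  = prime∤prime pp pq p≢q p∣q
    ... | inj₂ p∣1+i = ℕ.<⇒≱ (ℕ.s≤s i<p) (∣⇒≤ p∣1+i)

  upTo-pq-↭ : ∀ {p q} → Prime p → Prime q → p ≢ q →
              applyUpTo suc (p ℕ.* q) ↭ multiples p q ++ multiples q (p ∸ 1) ++ coprimesUpTo (p ℕ.* q)
  upTo-pq-↭ {p} {q} pp pq p≢q =
    ↭.↭-trans (↭-filter-partition (p ∣?_) l)
   (↭.↭-trans (↭.++⁺ˡ (filter (p ∣?_) l) (↭-filter-partition (q ∣?_) l′))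
              (↭.↭-reflexive (cong₂ _++_ p-multiples (cong₂ _++_ q-multiples coprimes))))
    where
    instance
      _ = prime⇒nonZero pp
      _ = prime⇒nonZero pq
    l  = applyUpTo suc (p ℕ.* q)
    l′ = filter (∁? (p ∣?_)) l
    p-multiples : filter (p ∣?_) l ≡ multiples p q
    p-multiples = ≡.trans (cong (λ n → filter (p ∣?_) (applyUpTo suc n)) (ℕ.*-comm p q)) (filter-∣-upTo p q)
    q-multiples : filter (q ∣?_) l′ ≡ multiples q (p ∸ 1)
    q-multiples = begin
      filter (q ∣?_) l′                              ≡⟨ filter-comm (q ∣?_) (∁? (p ∣?_)) l ⟩
      filter (∁? (p ∣?_)) (filter (q ∣?_) l)         ≡⟨ cong (filter (∁? (p ∣?_))) (filter-∣-upTo q p) ⟩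
      filter (∁? (p ∣?_)) (multiples q p)            ≡⟨ filter-∤-multiples pp pq p≢q ⟩
      multiples q (p ∸ 1)                            ∎
    coprimes : filter (∁? (q ∣?_)) l′ ≡ coprimesUpTo (p ℕ.* q)
    coprimes = ≡.trans (filter-filter (∁? (q ∣?_)) (∁? (p ∣?_)) l)
                       (List.filter-≐ _ (λ j → gcd j (p ℕ.* q) ℕ.≟ 1) (coprime-pq pp pq) l)

  totient< : ∀ n → 1 < n → totient n < n
  totient< (suc m) 1<n = ≡.subst (totient (suc m) <_) (List.length-applyUpTo suc (suc m))
    (List.filter-notAll (λ j → gcd j (suc m) ℕ.≟ 1) (applyUpTo suc (suc m))
                        (applyUpTo⁺ suc {i = m} not-coprime (ℕ.n<1+n m)))
    where
    not-coprime : ¬ gcd (suc m) (suc m) ≡ 1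
    not-coprime g = ℕ.<⇒≢ 1<n (≡.sym (gcd≡1⇒coprime g (∣-refl , ∣-refl)))

module Representations {p q : ℕ} (p-prime : Prime p) (q-prime : Prime q) (p≢q : p ≢ q) where
  open import Data.Nat.Divisibility
  open import Data.Nat.Induction using (<-rec)
  open import Data.Product.Base using (∃-syntax)
  open NumberTheory using (prime∤prime)

  [q∣_] : ℕ → ℕ
  [q∣ k ] with q ∣? k
  ... | yes _ = 1
  ... | no  _ = 0

  [q∣]-yes : ∀ {k} → q ∣ k → [q∣ k ] ≡ 1
  [q∣]-yes {k} q∣k with q ∣? k
  ... | yes _   = ≡-refl
  ... | no  q∤k = contradiction q∣k q∤k

  [q∣]-no : ∀ {k} → ¬ q ∣ k → [q∣ k ] ≡ 0
  [q∣]-no {k} q∤k with q ∣? k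
  ... | yes q∣k = contradiction q∣k q∤k
  ... | no  _   = ≡-refl

  [q∣]≤1 : ∀ k → [q∣ k ] ≤ 1
  [q∣]≤1 k with q ∣? k
  ... | yes _ = ℕ.≤-refl
  ... | no  _ = ℕ.z≤n

  [q∣]-periodic : ∀ {k} → q ≤ k → [q∣ k ] ≡ [q∣ k ∸ q ]
  [q∣]-periodic {k} q≤k with q ∣? k | q ∣? (k ∸ q)
  ... | yes _   | yes _   = ≡-refl
  ... | no  _   | no  _   = ≡-refl
  ... | yes q∣k | no  q∤k′ =
    contradiction (∣m+n∣m⇒∣n (≡.subst (q ∣_) (≡.sym (ℕ.m+[n∸m]≡n q≤k)) q∣k) ∣-refl) q∤k′
  ... | no  q∤k | yes q∣k′ = contradiction (∣m∸n∣n⇒∣m q q≤k q∣k′ ∣-refl) q∤k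

  private
    instance
      _ = prime⇒nonZero p-prime

    k∸p<k : ∀ {k} → p ≤ k → k ∸ p < k
    k∸p<k p≤k = ℕ.∸-monoʳ-< (ℕ.>-nonZero⁻¹ p) p≤k

    count : ℕ → ℕ → ℕ
    count zero    k = 0
    count (suc f) k with p ℕ.≤? k
    ... | yes _ = [q∣ k ] ℕ.+ count f (k ∸ p)
    ... | no  _ = [q∣ k ]

    count-fuel : ∀ f f′ k → k < f → k < f′ → count f k ≡ count f′ k
    count-fuel (suc f) (suc f′) k (ℕ.s≤s k≤f) (ℕ.s≤s k≤f′) with p ℕ.≤? k
    ... | yes p≤k = cong ([q∣ k ] ℕ.+_) (count-fuel f f′ (k ∸ p)
                      (ℕ.<-≤-trans (k∸p<k p≤k) k≤f) (ℕ.<-≤-trans (k∸p<k p≤k) k≤f′))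
    ... | no  _   = ≡-refl

  -- reps k counts the pairs (a, b) with a p + b q = k, one for each a with q ∣ k − a p;
  -- count computes it with fuel f > k.
  reps : ℕ → ℕ
  reps k = count (suc k) k

  reps-≥ : ∀ {k} → p ≤ k → reps k ≡ [q∣ k ] ℕ.+ reps (k ∸ p)
  reps-≥ {k} p≤k with p ℕ.≤? k
  ... | yes _   = cong ([q∣ k ] ℕ.+_) (count-fuel k (suc (k ∸ p)) (k ∸ p) (k∸p<k p≤k) ℕ.≤-refl)
  ... | no  p≰k = contradiction p≤k p≰k

  reps-< : ∀ {k} → k < p → reps k ≡ [q∣ k ]
  reps-< {k} k<p with p ℕ.≤? k
  ... | yes p≤k = contradiction p≤k (ℕ.<⇒≱ k<p)
  ... | no  _   = ≡-refl

  Representable : ℕ → Set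
  Representable k = ∃[ a ] ∃[ b ] a ℕ.* p ℕ.+ b ℕ.* q ≡ k

  q∣⇒representable : ∀ {k} → q ∣ k → Representable k
  q∣⇒representable (divides b k≡bq) = 0 , b , ≡.sym k≡bq

  representable-+p : ∀ {k} → p ≤ k → Representable (k ∸ p) → Representable k
  representable-+p p≤k (a , b , eq) = suc a , b ,
    ≡.trans (ℕ.+-assoc p (a ℕ.* p) _) (≡.trans (cong (p ℕ.+_) eq) (ℕ.m+[n∸m]≡n p≤k))

  reps>0⇒representable : ∀ k → 0 < reps k → Representable k
  reps>0⇒representable = <-rec _ λ k rec 0<r → step k rec 0<r (q ∣? k) (p ℕ.≤? k)
    where
    step : ∀ k → (∀ {j} → j < k → 0 < reps j → Representable j) → 0 < reps k →
           Dec (q ∣ k) → Dec (p ≤ k) → Representable k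
    step k rec 0<r (yes q∣k) _         = q∣⇒representable q∣k
    step k rec 0<r (no  q∤k) (no  p≰k) =
      contradiction (≡.subst (0 <_) (≡.trans (reps-< (ℕ.≰⇒> p≰k)) ([q∣]-no q∤k)) 0<r) (λ ())
    step k rec 0<r (no  q∤k) (yes p≤k) = representable-+p p≤k (rec (k∸p<k p≤k)
      (≡.subst (0 <_) (≡.trans (reps-≥ p≤k) (cong (ℕ._+ reps (k ∸ p)) ([q∣]-no q∤k))) 0<r))

  q∣⇒a≡0 : ∀ {k a b} → k < p ℕ.* q → q ∣ k → a ℕ.* p ℕ.+ b ℕ.* q ≡ k → a ≡ 0
  q∣⇒a≡0 {a = zero} _ _ _ = ≡-refl
  q∣⇒a≡0 {k} {suc a} {b} k<pq q∣k eq with euclidsLemma (suc a) p q-prime q∣[1+a]p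
    where
    q∣[1+a]p : q ∣ suc a ℕ.* p
    q∣[1+a]p = ∣m+n∣m⇒∣n (≡.subst (q ∣_) (≡.trans (≡.sym eq) (ℕ.+-comm _ (b ℕ.* q))) q∣k) (n∣m*n b)
  ... | inj₂ q∣p   = contradiction q∣p (prime∤prime q-prime p-prime (p≢q ∘ ≡.sym))
  ... | inj₁ q∣1+a = contradiction k<pq (ℕ.≤⇒≯ (begin
    p ℕ.* q                  ≡⟨ ℕ.*-comm p q ⟩
    q ℕ.* p                  ≤⟨ ℕ.*-monoˡ-≤ p (∣⇒≤ q∣1+a) ⟩
    suc a ℕ.* p              ≤⟨ ℕ.m≤m+n (suc a ℕ.* p) (b ℕ.* q) ⟩
    suc a ℕ.* p ℕ.+ b ℕ.* q  ≡⟨ eq ⟩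
    k                        ∎))
    where open ℕ.≤-Reasoning

  q∣⇒¬representable[∸p] : ∀ {k} → p ≤ k → k < p ℕ.* q → q ∣ k → ¬ Representable (k ∸ p)
  q∣⇒¬representable[∸p] p≤k k<pq q∣k r@(a , b , _)
    with q∣⇒a≡0 {a = suc a} {b} k<pq q∣k (proj₂ (proj₂ (representable-+p p≤k r)))
  ... | ()

  reps≤1 : ∀ k → k < p ℕ.* q → reps k ≤ 1
  reps≤1 = <-rec _ λ k rec k<pq → step k rec k<pq (p ℕ.≤? k) (q ∣? k)
    where
    step : ∀ k → (∀ {j} → j < k → j < p ℕ.* q → reps j ≤ 1) → k < p ℕ.* q →
           Dec (p ≤ k) → Dec (q ∣ k) → reps k ≤ 1
    step k rec k<pq (no  p≰k) _         = ≡.subst (_≤ 1) (≡.sym (reps-< (ℕ.≰⇒> p≰k))) ([q∣]≤1 k)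
    step k rec k<pq (yes p≤k) (yes q∣k) =
      ≡.subst (_≤ 1) (≡.sym (≡.trans (reps-≥ p≤k) (cong (ℕ._+ reps (k ∸ p)) ([q∣]-yes q∣k))))
              (ℕ.+-monoʳ-≤ 1 (ℕ.≮⇒≥ (q∣⇒¬representable[∸p] p≤k k<pq q∣k ∘ reps>0⇒representable _)))
    step k rec k<pq (yes p≤k) (no  q∤k) =
      ≡.subst (_≤ 1) (≡.sym (≡.trans (reps-≥ p≤k) (cong (ℕ._+ reps (k ∸ p)) ([q∣]-no q∤k))))
              (rec (k∸p<k p≤k) (ℕ.≤-<-trans (ℕ.m∸n≤m k p) k<pq))

module CyclotomicPQ {c ℓ} (R : CommutativeRing c ℓ) (noZeroDivisors : RootsOfUnity.NoZeroDivisors R)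
  {p q : ℕ} (p-prime : Prime p) (q-prime : Prime q) (p≢q : p ≢ q)
  (ω : CommutativeRing.Carrier R) (ω-prim : RootsOfUnity.IsPrimitiveRoot R ω (p ℕ.* q)) where

  open CommutativeRing R hiding (zero)
  open Poly R using (pow; H; HArgs; coeff; cyclotomic)
  open PowerSeries R
  open RootsOfUnity R
  open LinearFactors R using (linearFactors; cyclotomic≡linearFactors; coeff-linearFactors)
  open IntegerCoefficients R
  open NumberTheory using (multiples; upTo-pq-↭; totient<)
  open Representations p-prime q-prime p≢q
  open import Algebra.Properties.Semiring.Mult.TCOptimised semiring using (×-homo-+) renaming (_×_ to _·_)
  open import Data.Nat.Divisibility using (_∣0; ∣⇒≤)

  private instance
    _ = prime⇒nonZero p-prime
    _ = prime⇒nonZero q-prime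
    _ = ℕ.m*n≢0 p q

  ζp ζq : Carrier
  ζp = pow ω q
  ζq = pow ω p

  ζp-prim : IsPrimitiveRoot ζp p
  ζp-prim = pow-primitive q p (ℕ.>-nonZero⁻¹ q) (≡.subst (IsPrimitiveRoot ω) (ℕ.*-comm p q) ω-prim)

  ζq-prim : IsPrimitiveRoot ζq q
  ζq-prim = pow-primitive p q (ℕ.>-nonZero⁻¹ p) ω-prim

  as bs ρ : List Carrier
  as = powers ζp (p ∸ 1)
  bs = powers ζq (q ∸ 1)
  ρ  = 1# ∷ as ++ bs

  C : Operator
  C = lins (map (pow ω) (coprimesUpTo (p ℕ.* q)))

  lins-multiples : ∀ d k t → lins (map (pow ω) (multiples d k)) t ≋ lins (powers (pow ω d) k) t
  lins-multiples d k t = ≋-trans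
    (≋-reflexive (cong (λ xs → lins xs t) (≡.sym (List.map-∘ (applyUpTo suc k)))))
    (lins-map-cong (pow-* ω d) (applyUpTo suc k) t)

  lins-ρ : ∀ t → lins ρ t ≋ cyc q (lins as t)
  lins-ρ t = ≋-trans (lins-↭ (prep 1# (↭.++-comm as bs)) t)
            (≋-trans (lin-cong 1# (lins-++ bs as t)) (lins-roots noZeroDivisors q ζq-prim (lins as t)))

  module _ where
    open import Relation.Binary.Reasoning.Setoid ≋-setoid

    lins-ρ-C : ∀ t → lins ρ (C t) ≋ cyc (p ℕ.* q) t
    lins-ρ-C t = begin
      lins ρ (C t)                        ≈⟨ lins-ρ (C t) ⟩
      cyc q (lins as (C t))               ≈⟨ lins-powers noZeroDivisors q ζq-prim _ ⟨
      lins (powers ζq q) (lins as (C t))  ≈⟨ lins-multiples p q _ ⟨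
      lins ps (lins as (C t))             ≈⟨ lins-cong ps (lins-multiples q (p ∸ 1) (C t)) ⟨
      lins ps (lins qs (C t))             ≈⟨ lins-cong ps (lins-++ qs cs t) ⟨
      lins ps (lins (qs ++ cs) t)         ≈⟨ lins-++ ps (qs ++ cs) t ⟨
      lins (ps ++ qs ++ cs) t             ≡⟨ cong (λ xs → lins xs t) ωs-++ ⟨
      lins (ωs (multiples p q ++ multiples q (p ∸ 1) ++ coprimesUpTo (p ℕ.* q))) t
                                          ≈⟨ lins-↭ (↭.map⁺ (pow ω) (upTo-pq-↭ p-prime q-prime p≢q)) t ⟨
      lins (powers ω (p ℕ.* q)) t         ≈⟨ lins-powers noZeroDivisors (p ℕ.* q) ω-prim t ⟩
      cyc (p ℕ.* q) t                     ∎
      where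
      ωs : List ℕ → List Carrier
      ωs = map (pow ω)
      ps qs cs : List Carrier
      ps = ωs (multiples p q)
      qs = ωs (multiples q (p ∸ 1))
      cs = ωs (coprimesUpTo (p ℕ.* q))
      ωs-++ : ωs (multiples p q ++ multiples q (p ∸ 1) ++ coprimesUpTo (p ℕ.* q)) ≡ ps ++ qs ++ cs
      ωs-++ = ≡.trans (List.map-++ (pow ω) (multiples p q) _)
                      (cong (ps ++_) (List.map-++ (pow ω) (multiples q (p ∸ 1)) _))

  N M : Series
  N k = reps k · 1#
  M k = [q∣ k ] · 1#

  module _ where
    open import Relation.Binary.Reasoning.Setoid setoid

    cyc-p-N : cyc p N ≋ M
    cyc-p-N k = by-cases (p ℕ.≤? k)
      where
      by-cases : Dec (p ≤ k) → cyc p N k ≈ M k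
      by-cases (yes p≤k) = begin
        N k - shift p N k                             ≡⟨ cong (λ s → N k - s) (shift-≥ p N k p≤k) ⟩
        N k - N (k ∸ p)                               ≡⟨ cong (λ n → n · 1# - N (k ∸ p)) (reps-≥ p≤k) ⟩
        ([q∣ k ] ℕ.+ reps (k ∸ p)) · 1# - N (k ∸ p)   ≈⟨ +-congʳ (×-homo-+ 1# [q∣ k ] (reps (k ∸ p))) ⟩
        (M k + N (k ∸ p)) - N (k ∸ p)                 ≈⟨ solve 2 (λ a b → (a :+ b) :- b := a) refl _ _ ⟩
        M k                                           ∎
      by-cases (no p≰k) = begin
        N k - shift p N k  ≡⟨ cong (λ s → N k - s) (shift-< p N k (ℕ.≰⇒> p≰k)) ⟩
        N k - 0#           ≈⟨ solve 1 (λ a → a :- con (+ 0) := a) refl (N k) ⟩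
        N k                ≡⟨ cong (_· 1#) (reps-< (ℕ.≰⇒> p≰k)) ⟩
        M k                ∎

    cyc-q-M : cyc q M ≋ δ
    cyc-q-M zero    = begin
      M 0 - shift q M 0  ≡⟨ cong₂ (λ n s → n · 1# - s) ([q∣]-yes (q ∣0)) (shift-< q M 0 (ℕ.>-nonZero⁻¹ q)) ⟩
      1# - 0#            ≈⟨ solve 0 (con (+ 1) :- con (+ 0) := con (+ 1)) refl ⟩
      1#                 ∎
    cyc-q-M (suc k) = by-cases (q ℕ.≤? suc k)
      where
      by-cases : Dec (q ≤ suc k) → cyc q M (suc k) ≈ 0#
      by-cases (yes q≤k) = begin
        M (suc k) - shift q M (suc k)
          ≡⟨ cong₂ (λ n s → n · 1# - s) ([q∣]-periodic q≤k) (shift-≥ q M (suc k) q≤k) ⟩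
        M (suc k ∸ q) - M (suc k ∸ q)  ≈⟨ -‿inverseʳ _ ⟩
        0#                             ∎
      by-cases (no q≰k) = begin
        M (suc k) - shift q M (suc k)
          ≡⟨ cong₂ (λ n s → n · 1# - s) ([q∣]-no (q≰k ∘ ∣⇒≤)) (shift-< q M (suc k) (ℕ.≰⇒> q≰k)) ⟩
        0# - 0#                        ≈⟨ -‿inverseʳ 0# ⟩
        0#                             ∎

  module _ where
    open import Relation.Binary.Reasoning.Setoid ≋-setoid

    lins-ρ-N : lins ρ (lin 1# N) ≋ δ
    lins-ρ-N = begin
      lins ρ (lin 1# N)         ≈⟨ lins-ρ (lin 1# N) ⟩
      cyc q (lins as (lin 1# N)) ≈⟨ cyc-cong q (lin-lins-comm 1# as N) ⟨
      cyc q (lins (1# ∷ as) N)  ≈⟨ cyc-cong q (lins-roots noZeroDivisors p ζp-prim N) ⟩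
      cyc q (cyc p N)           ≈⟨ cyc-cong q cyc-p-N ⟩
      cyc q M                   ≈⟨ cyc-q-M ⟩
      δ                         ∎

  h : Series
  h = lins⁻¹ ρ δ

  C-δ≋cyc-h : C δ ≋ cyc (p ℕ.* q) h
  C-δ≋cyc-h = ≋-trans (lins-transpose ρ (lins-ρ-C δ)) (≋-sym (cyc-lins⁻¹-comm (p ℕ.* q) ρ δ))

  lin-N≋h : lin 1# N ≋ h
  lin-N≋h = lins-transpose ρ lins-ρ-N

  Bit Trit : Carrier → Set ℓ
  Bit x = x ≈ 0# ⊎ x ≈ 1#
  Trit x = x ≈ - 1# ⊎ x ≈ 0# ⊎ x ≈ 1#

  bit-difference : ∀ {a b} → Bit a → Bit b → Trit (a - 1# * b)
  bit-difference {a} {b} a-bit b-bit with a-bit | b-bit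
  ... | inj₁ a≈0 | inj₁ b≈0 = inj₂ (inj₁ (trans (+-cong a≈0 (-‿cong (*-congˡ b≈0)))
                                (solve 0 (con (+ 0) :- con (+ 1) :* con (+ 0) := con (+ 0)) refl)))
  ... | inj₁ a≈0 | inj₂ b≈1 = inj₁ (trans (+-cong a≈0 (-‿cong (*-congˡ b≈1)))
                                (solve 0 (con (+ 0) :- con (+ 1) :* con (+ 1) := :- con (+ 1)) refl))
  ... | inj₂ a≈1 | inj₁ b≈0 = inj₂ (inj₂ (trans (+-cong a≈1 (-‿cong (*-congˡ b≈0)))
                                (solve 0 (con (+ 1) :- con (+ 1) :* con (+ 0) := con (+ 1)) refl)))
  ... | inj₂ a≈1 | inj₂ b≈1 = inj₂ (inj₁ (trans (+-cong a≈1 (-‿cong (*-congˡ b≈1)))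
                                (solve 0 (con (+ 1) :- con (+ 1) :* con (+ 1) := con (+ 0)) refl)))

  N-bit : ∀ k → k < p ℕ.* q → Bit (N k)
  N-bit k k<pq with reps k | reps≤1 k k<pq
  ... | 0     | _ = inj₁ refl
  ... | 1     | _ = inj₂ refl
  ... | suc (suc _) | ℕ.s≤s ()

  lin-N-trit : ∀ k → k < p ℕ.* q → Trit (lin 1# N k)
  lin-N-trit zero    0<pq = bit-difference (N-bit 0 0<pq) (inj₁ refl)
  lin-N-trit (suc k) k<pq = bit-difference (N-bit (suc k) k<pq) (N-bit k (ℕ.<-trans (ℕ.n<1+n k) k<pq))

  ≤totient⇒<pq : ∀ {k} → k ≤ totient (p ℕ.* q) → k < p ℕ.* q
  ≤totient⇒<pq k≤φ = ℕ.≤-<-trans k≤φ (totient< (p ℕ.* q) 1<pq)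
    where
    1<pq : 1 < p ℕ.* q
    1<pq = ℕ.*-mono-≤ (ℕ.nonTrivial⇒n>1 p {{prime⇒nonTrivial p-prime}}) (ℕ.>-nonZero⁻¹ q)

  H≈h : ∀ k → H k (HArgs ζp ζq p q) ≈ h k
  H≈h = H≈lins⁻¹ ρ

  coeff-cyclotomic : ∀ k → k ≤ totient (p ℕ.* q) →
                     coeff (cyclotomic ω (p ℕ.* q)) (totient (p ℕ.* q) ∸ k) ≈ H k (HArgs ζp ζq p q)
  coeff-cyclotomic k k≤φ = begin
    coeff (cyclotomic ω (p ℕ.* q)) (totient (p ℕ.* q) ∸ k)
      ≡⟨ cong (λ f → coeff f (totient (p ℕ.* q) ∸ k)) (cyclotomic≡linearFactors ω (p ℕ.* q)) ⟩
    coeff (linearFactors (map (pow ω) (coprimesUpTo (p ℕ.* q)))) (totient (p ℕ.* q) ∸ k)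
      ≈⟨ coeff-linearFactors (map (pow ω) (coprimesUpTo (p ℕ.* q))) _ k
           (≡.trans (ℕ.m∸n+n≡m k≤φ) (≡.sym (List.length-map (pow ω) (coprimesUpTo (p ℕ.* q))))) ⟩
    C δ k
      ≈⟨ C-δ≋cyc-h k ⟩
    h k - shift (p ℕ.* q) h k
      ≡⟨ cong (λ s → h k - s) (shift-< (p ℕ.* q) h k (≤totient⇒<pq k≤φ)) ⟩
    h k - 0#
      ≈⟨ solve 1 (λ a → a :- con (+ 0) := a) refl (h k) ⟩
    h k
      ≈⟨ H≈h k ⟨
    H k (HArgs ζp ζq p q)
      ∎
    where open import Relation.Binary.Reasoning.Setoid setoid

  H-trit : ∀ k → k < p ℕ.* q → Trit (H k (HArgs ζp ζq p q))
  H-trit k k<pq = Sum.map (trans H≈lin-N) (Sum.map (trans H≈lin-N) (trans H≈lin-N)) (lin-N-trit k k<pq)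
    where
    H≈lin-N : H k (HArgs ζp ζq p q) ≈ lin 1# N k
    H≈lin-N = trans (H≈h k) (sym (lin-N≋h k))

theorem1p3 : ∀ {c ℓ} (R : CommutativeRing c ℓ) →
  let open CommutativeRing R
      open Poly R
  in
  ¬ (1# ≈ 0#) →
  (∀ x y → x * y ≈ 0# → x ≈ 0# ⊎ y ≈ 0#) →
  (∀ n → ¬ (ofℕ (suc n) ≈ 0#)) →
  ∀ (p q : ℕ) → Prime p → Prime q → p ≢ q →
  ∀ (ω : Carrier) → pow ω (p ℕ.* q) ≈ 1# →
  (∀ d → 0 < d → d < p ℕ.* q → ¬ (pow ω d ≈ 1#)) →
  ∀ k → k ≤ totient (p ℕ.* q) →
    (coeff (cyclotomic ω (p ℕ.* q)) (totient (p ℕ.* q) ∸ k)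
       ≈ H k (HArgs (pow ω q) (pow ω p) p q))
    × (H k (HArgs (pow ω q) (pow ω p) p q) ≈ - 1#
       ⊎ H k (HArgs (pow ω q) (pow ω p) p q) ≈ 0#
       ⊎ H k (HArgs (pow ω q) (pow ω p) p q) ≈ 1#)
theorem1p3 R _ noZeroDivisors _ p q p-prime q-prime p≢q ω ωᵖᑫ≈1 ω-prim k k≤φ =
  coeff-cyclotomic k k≤φ , H-trit k (≤totient⇒<pq k≤φ)
  where open CyclotomicPQ R noZeroDivisors p-prime q-prime p≢q ω (ωᵖᑫ≈1 , ω-prim)
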